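{- Let $S$ be a numerical semigroup with multiplicity $m$ and embedding dimension $\nu$, and let $\mathrm{Ap}(S,m)=\{w_0=0<w_1<\dots<w_{m-1}\}$. Suppose that $w_{m-1}\ge w_{\alpha-1}+w_\alpha$ for some integer $\alpha$ with $1<\alpha<m-1$. If $\left(\frac{\alpha+3}{3}\right)\nu\ge m$, then $S$ satisfies Wilf's Conjecture, i.e. $f+1\le\nu n$.
   Context: A numerical semigroup is a submonoid of $(\mathbb N,+)$ with finite complement. $f$ is its Frobenius number (largest integer not in $S$), $m$ its smallest nonzero element, $\nu$ its minimal number of generators, and $n=|\{s\in S: s<f\}|$. The Apéry set is $\mathrm{Ap}(S,m)=\{s\in S: s-m\notin S\}$, which has exactly $m$ elements, listed increasingly. -}

module Defs where

open import Data.Nat using (ℕ; zero; suc; _+_; _*_; _≤_; _<_)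
open import Data.Bool using (Bool; true; false)
open import Data.List using (List; []; _∷_; length; filterᵇ; upTo)
open import Data.List.Membership.Propositional using (_∈_)
open import Data.List.Relation.Unary.All using (All)
open import Data.Product using (Σ; ∃; _×_; _,_)
open import Relation.Binary.PropositionalEquality using (_≡_; _≢_)
open import Relation.Nullary using (¬_)

record NumericalSemigroup : Set where
  field
    mem     : ℕ → Bool
    zero∈   : mem 0 ≡ true
    closed  : ∀ x y → mem x ≡ true → mem y ≡ true → mem (x + y) ≡ true
    cofinite : ∃ λ N → ∀ x → N ≤ x → mem x ≡ true

open NumericalSemigroup public

_∈S_ : ℕ → NumericalSemigroup → Set
x ∈S S = mem S x ≡ true

_∉S_ : ℕ → NumericalSemigroup → Set
x ∉S S = ¬ (x ∈S S)

IsFrobenius : NumericalSemigroup → ℕ → Set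
IsFrobenius S f = f ∉S S × (∀ x → f < x → x ∈S S)

IsMultiplicity : NumericalSemigroup → ℕ → Set
IsMultiplicity S m = m ≢ 0 × m ∈S S × (∀ s → s ∈S S → s ≢ 0 → m ≤ s)

data InMonoid (G : List ℕ) : ℕ → Set where
  mzero : InMonoid G 0
  madd  : ∀ {g x} → g ∈ G → InMonoid G x → InMonoid G (g + x)

Generates : List ℕ → NumericalSemigroup → Set
Generates G S = All (λ g → g ∈S S) G × (∀ x → x ∈S S → InMonoid G x)

IsEmbeddingDimension : NumericalSemigroup → ℕ → Set
IsEmbeddingDimension S ν =
  (∃ λ G → Generates G S × length G ≡ ν) ×
  (∀ G → Generates G S → ν ≤ length G)

smallElements : NumericalSemigroup → ℕ → ℕ
smallElements S f = length (filterᵇ (mem S) (upTo f))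

-- Apéry set of S with respect to m: s ∈ S with s - m ∉ S (for s < m, s - m ∉ ℕ).
InApery : NumericalSemigroup → ℕ → ℕ → Set
InApery S m s = s ∈S S × (∀ t → t + m ≡ s → t ∉S S)

IsAperyEnumeration : NumericalSemigroup → ℕ → (ℕ → ℕ) → Set
IsAperyEnumeration S m w =
  (∀ i j → i < j → j < m → w i < w j) ×
  (∀ i → i < m → InApery S m (w i)) ×
  (∀ s → InApery S m s → ∃ λ i → i < m × w i ≡ s)

-- Each Apéry element w i starts the progression w i, w i + m, w i + 2m, … inside S, and the
-- progressions of distinct Apéry elements are disjoint, so n is at least the number of their terms
-- below f. Let b = w (α - 1) < a = w α, and let q, kb, ka be the indices of the last terms below f of
-- the progressions of 0, b and a. Counting the progressions of w 0 = 0, of w 1 … w (α - 1) ≤ b and of a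
-- gives n ≥ (q + 1) + (α - 1)(kb + 1) + (ka + 1). Now b < a gives ka ≤ kb, while
-- a + b ≤ w (m - 1) ≤ f + m gives q ≤ ka + kb + 2; together (α + 3)(q + 1) ≤ 3n.
-- As f < (q + 1) m, this yields (α + 3)(f + 1) ≤ 3mn ≤ (α + 3)νn.
module Submission where

open import Defs
open import Data.Nat using (ℕ; zero; suc; _+_; _*_; _∸_; _≤_; _<_; _≤′_; ≤′-refl; ≤′-step; z≤n; s≤s; _≤?_; NonZero; >-nonZero⁻¹; z<s)
open import Data.Nat.Properties
open import Data.Nat.Divisibility using (divides; _∣?_)
open import Data.Nat.DivMod using (_/_; _%_; m≡m%n+[m/n]*n; m/n*n≤m; m%n<n)
open import Data.Nat.Tactic.RingSolver using (solve-∀)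
open import Data.Bool using (Bool; true; false; _∧_)
open import Data.Bool.Properties using (T-≡; T-∧)
open import Data.List using ([_]; _++_; length; filterᵇ; upTo)
open import Data.List.Properties using (upTo-∷ʳ; filter-++; length-++)
open import Data.Product using (∃; _×_; _,_; proj₁; proj₂)
open import Data.Sum using (inj₁; inj₂)
open import Data.Empty using (⊥; ⊥-elim)
open import Algebra.Properties.CommutativeSemigroup +-commutativeSemigroup using (interchange)
open import Function using (_∘_)
open import Function.Bundles using (Equivalence)
open import Relation.Binary.PropositionalEquality using (_≡_; _≢_; refl; sym; cong; cong₂; subst; module ≡-Reasoning)
open import Relation.Nullary using (yes; no; T?)
open import Relation.Nullary.Decidable using (⌊_⌋; toWitness; fromWitness)

χ : Bool → ℕ
χ true  = 1
χ false = 0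

χ≡0 : ∀ {b} → b ≢ true → χ b ≡ 0
χ≡0 {false} _    = refl
χ≡0 {true}  b≢t = ⊥-elim (b≢t refl)

∑< : ℕ → (ℕ → ℕ) → ℕ
∑< zero    g = 0
∑< (suc n) g = ∑< n g + g n

syntax ∑< n (λ i → e) = ∑[ i < n ] e

∑-monoʳ-≤ : ∀ n {g h : ℕ → ℕ} → (∀ i → g i ≤ h i) → ∑< n g ≤ ∑< n h
∑-monoʳ-≤ zero    g≤h = z≤n
∑-monoʳ-≤ (suc n) g≤h = +-mono-≤ (∑-monoʳ-≤ n g≤h) (g≤h n)

∑-monoˡ-≤ : ∀ (g : ℕ → ℕ) {m n} → m ≤ n → ∑< m g ≤ ∑< n g
∑-monoˡ-≤ g {m} m≤n = go (≤⇒≤′ m≤n)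
  where
  go : ∀ {n} → m ≤′ n → ∑< m g ≤ ∑< n g
  go ≤′-refl       = ≤-refl
  go (≤′-step m≤n) = ≤-trans (go m≤n) (m≤m+n _ _)

∑-zero : ∀ n {g : ℕ → ℕ} → (∀ i → i < n → g i ≡ 0) → ∑< n g ≡ 0
∑-zero zero    _  = refl
∑-zero (suc n) g≡0 = cong₂ _+_ (∑-zero n (λ i i<n → g≡0 i (m<n⇒m<1+n i<n))) (g≡0 n (n<1+n n))

∑-distrib-+ : ∀ n (g h : ℕ → ℕ) → ∑[ i < n ] (g i + h i) ≡ ∑< n g + ∑< n h
∑-distrib-+ zero    g h = refl
∑-distrib-+ (suc n) g h = begin
  ∑[ i < n ] (g i + h i) + (g n + h n) ≡⟨ cong (_+ (g n + h n)) (∑-distrib-+ n g h) ⟩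
  ∑< n g + ∑< n h + (g n + h n)        ≡⟨ interchange (∑< n g) (∑< n h) (g n) (h n) ⟩
  ∑< n g + g n + (∑< n h + h n)        ∎
  where open ≡-Reasoning

∑-comm : ∀ m n (g : ℕ → ℕ → ℕ) → ∑[ i < m ] ∑[ j < n ] g i j ≡ ∑[ j < n ] ∑[ i < m ] g i j
∑-comm zero    n g = sym (∑-zero n (λ _ _ → refl))
∑-comm (suc m) n g = begin
  ∑[ i < m ] ∑[ j < n ] g i j + ∑[ j < n ] g m j   ≡⟨ cong (_+ ∑[ j < n ] g m j) (∑-comm m n g) ⟩
  ∑[ j < n ] ∑[ i < m ] g i j + ∑[ j < n ] g m j   ≡⟨ sym (∑-distrib-+ n (λ j → ∑[ i < m ] g i j) (g m)) ⟩
  ∑[ j < n ] (∑[ i < m ] g i j + g m j)            ∎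
  where open ≡-Reasoning

∑-suc : ∀ n (g : ℕ → ℕ) → ∑< (suc n) g ≡ g 0 + ∑[ i < n ] g (suc i)
∑-suc zero    g = +-comm 0 (g 0)
∑-suc (suc n) g = begin
  ∑< (suc n) g + g (suc n)                  ≡⟨ cong (_+ g (suc n)) (∑-suc n g) ⟩
  g 0 + ∑[ i < n ] g (suc i) + g (suc n)    ≡⟨ +-assoc (g 0) _ _ ⟩
  g 0 + ∑[ i < suc n ] g (suc i)            ∎
  where open ≡-Reasoning

*≤∑ : ∀ n {c} {g : ℕ → ℕ} → (∀ i → i < n → c ≤ g i) → n * c ≤ ∑< n g
*≤∑ zero    _   = z≤n
*≤∑ (suc n) {c} c≤g = begin
  c + n * c      ≡⟨ +-comm c (n * c) ⟩
  n * c + c      ≤⟨ +-mono-≤ (*≤∑ n (λ i i<n → c≤g i (m<n⇒m<1+n i<n))) (c≤g n (n<1+n n)) ⟩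
  ∑< (suc n) _   ∎
  where open ≤-Reasoning

∑χ≤χ : ∀ n {p : ℕ → Bool} {b : Bool} →
  (∀ {i j} → i < j → j < n → p i ≡ true → p j ≡ true → ⊥) →
  (∀ {i} → i < n → p i ≡ true → b ≡ true) →
  ∑[ i < n ] χ (p i) ≤ χ b
∑χ≤χ zero    _ _ = z≤n
∑χ≤χ (suc n) {p} {b} disjoint sound with p n in pn≡
... | false = subst (_≤ χ b) (sym (+-identityʳ _))
                (∑χ≤χ n (λ i<j j<n → disjoint i<j (m<n⇒m<1+n j<n)) (sound ∘ m<n⇒m<1+n))
... | true rewrite sound (n<1+n n) pn≡ =
  ≤-reflexive (cong (_+ 1) (∑-zero n (λ i i<n → χ≡0 (λ pi≡ → disjoint i<n (n<1+n n) pi≡ pn≡))))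

length-filterᵇ-upTo : ∀ (p : ℕ → Bool) n → length (filterᵇ p (upTo n)) ≡ ∑[ y < n ] χ (p y)
length-filterᵇ-upTo p zero    = refl
length-filterᵇ-upTo p (suc n) = begin
  length (filterᵇ p (upTo (suc n)))                      ≡⟨ cong (length ∘ filterᵇ p) (sym (upTo-∷ʳ n)) ⟩
  length (filterᵇ p (upTo n ++ [ n ]))                   ≡⟨ cong length (filter-++ (T? ∘ p) (upTo n) [ n ]) ⟩
  length (filterᵇ p (upTo n) ++ filterᵇ p [ n ])         ≡⟨ length-++ (filterᵇ p (upTo n)) ⟩
  length (filterᵇ p (upTo n)) + length (filterᵇ p [ n ]) ≡⟨ cong₂ _+_ (length-filterᵇ-upTo p n) (length-filterᵇ-[ n ]) ⟩
  ∑[ y < suc n ] χ (p y)                                 ∎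
  where
  open ≡-Reasoning
  length-filterᵇ-[_] : ∀ x → length (filterᵇ p [ x ]) ≡ χ (p x)
  length-filterᵇ-[ x ] with p x
  ... | true  = refl
  ... | false = refl

onProgression : ℕ → ℕ → ℕ → Bool
onProgression m x y = ⌊ x ≤? y ⌋ ∧ ⌊ m ∣? (y ∸ x) ⌋

onProgression-term : ∀ m x k → onProgression m x (x + k * m) ≡ true
onProgression-term m x k = Equivalence.to T-≡ (Equivalence.from (T-∧ {⌊ x ≤? x + k * m ⌋})
  (fromWitness (m≤m+n x (k * m)) , fromWitness (divides k (m+n∸m≡n x (k * m)))))

onProgression⇒term : ∀ {m x y} → onProgression m x y ≡ true → ∃ λ k → y ≡ x + k * m
onProgression⇒term {m} {x} {y} on with Equivalence.to (T-∧ {⌊ x ≤? y ⌋}) (Equivalence.from T-≡ on)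
... | x≤y , m∣y∸x with toWitness {a? = m ∣? (y ∸ x)} m∣y∸x
...   | divides k y∸x≡k*m = k , (begin
  y             ≡⟨ m+[n∸m]≡n (toWitness {a? = x ≤? y} x≤y) ⟨
  x + (y ∸ x)   ≡⟨ cong (x +_) y∸x≡k*m ⟩
  x + k * m     ∎)
  where open ≡-Reasoning

onProgression-count : ∀ m .{{_ : NonZero m}} x k {n} → x + k * m < n →
  suc k ≤ ∑[ y < n ] χ (onProgression m x y)
onProgression-count m x k {n} t<n = begin
  suc k                                     ≡⟨ +-comm 1 k ⟩
  k + 1                                     ≤⟨ +-monoˡ-≤ 1 (earlierTerms k) ⟩
  ∑[ y < t ] χ (onProgression m x y) + 1    ≡⟨ cong (λ b → ∑[ y < t ] χ (onProgression m x y) + χ b)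
                                                    (onProgression-term m x k) ⟨
  ∑[ y < suc t ] χ (onProgression m x y)    ≤⟨ ∑-monoˡ-≤ _ t<n ⟩
  ∑[ y < n ] χ (onProgression m x y)        ∎
  where
  open ≤-Reasoning
  t : ℕ
  t = x + k * m
  earlierTerms : ∀ k → k ≤ ∑[ y < x + k * m ] χ (onProgression m x y)
  earlierTerms zero    = z≤n
  earlierTerms (suc k) = onProgression-count m x k (+-monoʳ-< x (m<n+m (k * m) (>-nonZero⁻¹ m)))

module _ (S : NumericalSemigroup) {m : ℕ} (m∈S : m ∈S S) where

  *-∈S : ∀ k → (k * m) ∈S S
  *-∈S zero    = zero∈ S
  *-∈S (suc k) = closed S m (k * m) m∈S (*-∈S k)

  +*-∈S : ∀ {x} → x ∈S S → ∀ k → (x + k * m) ∈S S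
  +*-∈S x∈S k = closed S _ _ x∈S (*-∈S k)

  onProgression-∈S : ∀ {x y} → x ∈S S → onProgression m x y ≡ true → y ∈S S
  onProgression-∈S {x} {y} x∈S on with onProgression⇒term {m} {x} {y} on
  ... | k , refl = +*-∈S x∈S k

  -- If the progressions of x < z meet, then z ≡ (x + e * m) + m with x + e * m ∈ S.
  apery-onProgression-disjoint : ∀ {x z y} → x ∈S S → InApery S m z → x < z →
    onProgression m x y ≡ true → onProgression m z y ≡ true → ⊥
  apery-onProgression-disjoint {x} {z} {y} x∈S (_ , z∸m∉S) x<z onx onz
    with onProgression⇒term {m} {x} {y} onx | onProgression⇒term {m} {z} {y} onz
  ... | k , refl | l , x+km≡z+lm with m≤n⇒∃[o]m+o≡n l<k
    where
    l<k : l < k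
    l<k = *-cancelʳ-< m l k (+-cancelˡ-< x (l * m) (k * m) (begin-strict
      x + l * m   <⟨ +-monoˡ-< (l * m) x<z ⟩
      z + l * m   ≡⟨ x+km≡z+lm ⟨
      x + k * m   ∎))
      where open ≤-Reasoning
  ...   | e , refl = z∸m∉S (x + e * m) (sym (+-cancelʳ-≡ (l * m) z _ (begin
      z + l * m                  ≡⟨ x+km≡z+lm ⟨
      x + (suc l + e) * m        ≡⟨ regroup x l e m ⟩
      x + e * m + m + l * m      ∎))) (+*-∈S x∈S e)
    where
    open ≡-Reasoning
    regroup : ∀ x l e m → x + (suc l + e) * m ≡ x + e * m + m + l * m
    regroup = solve-∀

  frobenius<multiple : ∀ {f k} → IsFrobenius S f → f ≤ k * m → f < k * m
  frobenius<multiple {k = k} (f∉S , _) f≤km =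
    ≤∧≢⇒< f≤km (λ f≡km → f∉S (subst (_∈S S) (sym f≡km) (*-∈S k)))

apery≤frobenius+m : ∀ {S m f w} → IsFrobenius S f → InApery S m w → w ≤ f + m
apery≤frobenius+m {S} {m} {f} {w} (_ , >f⇒∈S) (_ , w∸m∉S) with w ≤? f + m
... | yes w≤f+m = w≤f+m
... | no  w≰f+m =
  ⊥-elim (w∸m∉S (w ∸ m) (m∸n+n≡m m≤w) (>f⇒∈S (w ∸ m) (m+n≤o⇒m≤o∸n (suc f) f+m<w)))
  where
  f+m<w : f + m < w
  f+m<w = ≰⇒> w≰f+m
  m≤w : m ≤ w
  m≤w = ≤-trans (m≤n+m m f) (<⇒≤ f+m<w)

aperyEnumeration-zero : ∀ {S m w} → IsMultiplicity S m → IsAperyEnumeration S m w → w 0 ≡ 0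
aperyEnumeration-zero {S} {w = w} (m≢0 , _) (increasing , _ , complete)
  with complete 0 (zero∈ S , λ t t+m≡0 _ → m≢0 (m+n≡0⇒n≡0 t t+m≡0))
... | zero  , _   , w0≡0 = w0≡0
... | suc i , i<m , wi≡0 = ⊥-elim (n≮0 (subst (w 0 <_) wi≡0 (increasing 0 (suc i) z<s i<m)))

multiplicity<aperyEnumeration : ∀ {S m w i} → IsMultiplicity S m → IsAperyEnumeration S m w →
  0 < i → i < m → m < w i
multiplicity<aperyEnumeration {S} {m} {w} {i} mult@(_ , _ , minimal) enum@(increasing , apery , _) 0<i i<m =
  ≤∧≢⇒< (minimal (w i) wi∈S (m<n⇒n≢0 0<wi)) (λ m≡wi → wi∸m∉S 0 m≡wi (zero∈ S))
  where
  wi∈S : w i ∈S S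
  wi∈S = proj₁ (apery i i<m)
  wi∸m∉S : ∀ t → t + m ≡ w i → t ∉S S
  wi∸m∉S = proj₂ (apery i i<m)
  0<wi : 0 < w i
  0<wi = subst (_< w i) (aperyEnumeration-zero {S} {w = w} mult enum) (increasing 0 i 0<i i<m)

∑-onProgression≤smallElements : ∀ {S m f w r} → m ∈S S → IsAperyEnumeration S m w → r ≤ m →
  ∑[ i < r ] ∑[ y < f ] χ (onProgression m (w i) y) ≤ smallElements S f
∑-onProgression≤smallElements {S} {m} {f} {w} {r} m∈S (increasing , apery , _) r≤m = begin
  ∑[ i < r ] ∑[ y < f ] χ (onProgression m (w i) y)   ≡⟨ ∑-comm r f _ ⟩
  ∑[ y < f ] ∑[ i < r ] χ (onProgression m (w i) y)   ≤⟨ ∑-monoʳ-≤ f (λ y → ∑χ≤χ r (disjoint y) (sound y)) ⟩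
  ∑[ y < f ] χ (mem S y)                              ≡⟨ length-filterᵇ-upTo (mem S) f ⟨
  smallElements S f                                   ∎
  where
  open ≤-Reasoning
  w∈S : ∀ {i} → i < r → w i ∈S S
  w∈S i<r = proj₁ (apery _ (<-≤-trans i<r r≤m))
  disjoint : ∀ y {i j} → i < j → j < r →
    onProgression m (w i) y ≡ true → onProgression m (w j) y ≡ true → ⊥
  disjoint y {i} {j} i<j j<r = apery-onProgression-disjoint S m∈S (w∈S (<-trans i<j j<r))
    (apery j (<-≤-trans j<r r≤m)) (increasing i j i<j (<-≤-trans j<r r≤m))
  sound : ∀ y {i} → i < r → onProgression m (w i) y ≡ true → mem S y ≡ true
  sound y i<r = onProgression-∈S S m∈S (w∈S i<r)

aperyEnumeration-mono : ∀ {S m w k l} → IsAperyEnumeration S m w → k ≤ l → l < m → w k ≤ w l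
aperyEnumeration-mono {k = k} {l} (increasing , _) k≤l l<m with m≤n⇒m<n∨m≡n k≤l
... | inj₁ k<l  = <⇒≤ (increasing k l k<l l<m)
... | inj₂ refl = ≤-refl

onProgressions-count : ∀ {S m f w} .{{_ : NonZero m}} β q i j → IsMultiplicity S m →
  IsAperyEnumeration S m w → 2 + β < m → q * m < f → w (suc β) + i * m < f → w (2 + β) + j * m < f →
  suc q + (suc β * suc i + suc j) ≤ smallElements S f
onProgressions-count {S} {m} {f} {w} β q i j mult enum α<m qm<f b+im<f a+jm<f = begin
  suc q + (suc β * suc i + suc j)               ≤⟨ +-mono-≤ multiples (+-mono-≤ middle top) ⟩
  P 0 + (∑[ k < suc β ] P (suc k) + P (2 + β))  ≡⟨ ∑-suc (2 + β) P ⟨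
  ∑[ k < 3 + β ] P k                            ≤⟨ ∑-onProgression≤smallElements {S} {m} {f} {w} m∈S enum α<m ⟩
  smallElements S f                             ∎
  where
  open ≤-Reasoning
  m∈S : m ∈S S
  m∈S = proj₁ (proj₂ mult)
  P : ℕ → ℕ
  P k = ∑[ y < f ] χ (onProgression m (w k) y)
  multiples : suc q ≤ P 0
  multiples = onProgression-count m (w 0) q (subst (λ x → x + q * m < f) (sym w0≡0) qm<f)
    where
    w0≡0 : w 0 ≡ 0
    w0≡0 = aperyEnumeration-zero {S} {w = w} mult enum
  middle : suc β * suc i ≤ ∑[ k < suc β ] P (suc k)
  middle = *≤∑ (suc β) (λ k k<1+β → onProgression-count m (w (suc k)) i (≤-<-trans
    (+-monoˡ-≤ (i * m) (aperyEnumeration-mono {S} enum (s≤s (m<1+n⇒m≤n k<1+β)) (<-trans (n<1+n (suc β)) α<m)))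
    b+im<f))
  top : suc j ≤ P (2 + β)
  top = onProgression-count m (w (2 + β)) j a+jm<f

lastTermIndex : (m : ℕ) .{{_ : NonZero m}} → ℕ → ℕ → ℕ
lastTermIndex m x f = (f ∸ suc x) / m

lastTermIndex-< : ∀ m .{{_ : NonZero m}} {x f} → x < f → x + lastTermIndex m x f * m < f
lastTermIndex-< m {x} {f} x<f = begin-strict
  x + (f ∸ suc x) / m * m    ≤⟨ +-monoʳ-≤ x (m/n*n≤m (f ∸ suc x) m) ⟩
  x + (f ∸ suc x)            <⟨ n<1+n _ ⟩
  suc x + (f ∸ suc x)        ≡⟨ m+[n∸m]≡n x<f ⟩
  f                          ∎
  where open ≤-Reasoning

≤-lastTermIndex : ∀ m .{{_ : NonZero m}} x f → f ≤ x + suc (lastTermIndex m x f) * m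
≤-lastTermIndex m x f = begin
  f                            ≤⟨ m≤n+m∸n f (suc x) ⟩
  suc x + d                    ≡⟨ cong (suc x +_) (m≡m%n+[m/n]*n d m) ⟩
  suc x + (d % m + d / m * m)  ≡⟨ +-suc x _ ⟨
  x + (suc (d % m) + d / m * m) ≤⟨ +-monoʳ-≤ x (+-monoˡ-≤ (d / m * m) (m%n<n d m)) ⟩
  x + (m + d / m * m)          ∎
  where
  open ≤-Reasoning
  d : ℕ
  d = f ∸ suc x

lastTerm-antitone : ∀ m {a b f} i j → b ≤ a → a + i * m < f → f ≤ b + suc j * m → i ≤ j
lastTerm-antitone m {a} {b} {f} i j b≤a a+im<f f≤b+jm =
  m<1+n⇒m≤n (*-cancelʳ-< m i (suc j) (+-cancelˡ-< b (i * m) (suc j * m) (begin-strict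
    b + i * m        ≤⟨ +-monoˡ-≤ (i * m) b≤a ⟩
    a + i * m        <⟨ a+im<f ⟩
    f                ≤⟨ f≤b+jm ⟩
    b + suc j * m    ∎)))
  where open ≤-Reasoning

lastTerm-sum-bound : ∀ m {a b f} q i j → q * m < f → f ≤ a + suc i * m → f ≤ b + suc j * m →
  a + b ≤ f + m → q ≤ suc i + suc j
lastTerm-sum-bound m {a} {b} {f} q i j qm<f f≤a+im f≤b+jm a+b≤f+m =
  m<1+n⇒m≤n (*-cancelʳ-< m q (suc k) (<-≤-trans qm<f f≤km))
  where
  open ≤-Reasoning
  k : ℕ
  k = suc i + suc j
  f≤km : f ≤ suc k * m
  f≤km = +-cancelˡ-≤ f f (suc k * m) (begin
    f + f                           ≤⟨ +-mono-≤ f≤a+im f≤b+jm ⟩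
    a + suc i * m + (b + suc j * m) ≡⟨ regroup a b (suc i) (suc j) m ⟩
    a + b + k * m                   ≤⟨ +-monoˡ-≤ (k * m) a+b≤f+m ⟩
    f + m + k * m                   ≡⟨ +-assoc f m (k * m) ⟩
    f + suc k * m                   ∎)
    where
    regroup : ∀ a b i j m → a + i * m + (b + j * m) ≡ a + b + (i + j) * m
    regroup = solve-∀

count-arithmetic : ∀ β a b q {n} → a ≤ b → q ≤ suc a + suc b → suc q + (suc β * suc b + suc a) ≤ n →
  (2 + β + 3) * suc q ≤ 3 * n
count-arithmetic β a b q {n} a≤b q≤ count≤n with m≤n⇒∃[o]m+o≡n a≤b
... | d , refl = begin
  (2 + β + 3) * suc q                                    ≡⟨ split β (suc q) ⟩
  3 * suc q + (2 + β) * suc q                            ≤⟨ +-monoʳ-≤ (3 * suc q) (*-monoʳ-≤ (2 + β) (s≤s q≤)) ⟩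
  3 * suc q + (2 + β) * suc (suc a + suc (a + d))        ≤⟨ m≤m+n _ _ ⟩
  3 * suc q + (2 + β) * suc (suc a + suc (a + d)) + (β * a + 2 * (β * d) + 2 * a + d)
                                                         ≡⟨ expand β q a d ⟩
  3 * (suc q + (suc β * suc (a + d) + suc a))            ≤⟨ *-monoʳ-≤ 3 count≤n ⟩
  3 * n                                                  ∎
  where
  open ≤-Reasoning
  split : ∀ β Q → (2 + β + 3) * Q ≡ 3 * Q + (2 + β) * Q
  split = solve-∀
  expand : ∀ β q a d →
    3 * suc q + (2 + β) * suc (suc a + suc (a + d)) + (β * a + 2 * (β * d) + 2 * a + d) ≡
    3 * (suc q + (suc β * suc (a + d) + suc a))
  expand = solve-∀

wilf-from-count : ∀ c .{{_ : NonZero c}} {m ν f n} Q → f < Q * m → c * Q ≤ 3 * n → 3 * m ≤ c * ν →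
  suc f ≤ ν * n
wilf-from-count c {m} {ν} {f} {n} Q f<Qm cQ≤3n 3m≤cν = *-cancelˡ-≤ c (begin
  c * suc f      ≤⟨ *-monoʳ-≤ c f<Qm ⟩
  c * (Q * m)    ≡⟨ *-assoc c Q m ⟨
  c * Q * m      ≤⟨ *-monoˡ-≤ m cQ≤3n ⟩
  3 * n * m      ≡⟨ swap n m ⟩
  3 * m * n      ≤⟨ *-monoˡ-≤ n 3m≤cν ⟩
  c * ν * n      ≡⟨ *-assoc c ν n ⟩
  c * (ν * n)    ∎)
  where
  open ≤-Reasoning
  swap : ∀ n m → 3 * n * m ≡ 3 * m * n
  swap = solve-∀

theorem4 : (S : NumericalSemigroup) (m ν f : ℕ) (w : ℕ → ℕ) →
    IsMultiplicity S m → IsEmbeddingDimension S ν → IsFrobenius S f →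
    IsAperyEnumeration S m w →
    (∃ λ α → 1 < α × α < m ∸ 1 × w (α ∸ 1) + w α ≤ w (m ∸ 1) × 3 * m ≤ (α + 3) * ν) →
    suc f ≤ ν * smallElements S f
theorem4 S zero _ _ _ (m≢0 , _) _ _ _ _ = ⊥-elim (m≢0 refl)
theorem4 S (suc _) _ _ _ _ _ _ _ (zero , () , _)
theorem4 S (suc _) _ _ _ _ _ _ _ (suc zero , s≤s () , _)
theorem4 S m@(suc m-1) ν f w mult _ frob enum@(increasing , apery , _)
         (suc (suc β) , _ , α<m-1 , gap , 3m≤αν) =
  wilf-from-count (2 + β + 3) {ν = ν} {n = smallElements S f} (suc q)
    (frobenius<multiple S (proj₁ (proj₂ mult)) {k = suc q} frob (≤-lastTermIndex m 0 f))
    (count-arithmetic β ka kb q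
      (lastTerm-antitone m ka kb (<⇒≤ b<a) (lastTermIndex-< m a<f) (≤-lastTermIndex m b f))
      (lastTerm-sum-bound m q ka kb (lastTermIndex-< m 0<f) (≤-lastTermIndex m a f) (≤-lastTermIndex m b f)
                          a+b≤f+m)
      (onProgressions-count {S} β q kb ka mult enum α<m
        (lastTermIndex-< m 0<f) (lastTermIndex-< m b<f) (lastTermIndex-< m a<f)))
    3m≤αν
  where
  α<m : 2 + β < m
  α<m = m<n⇒m<1+n α<m-1
  b a q kb ka : ℕ
  b  = w (suc β)
  a  = w (2 + β)
  q  = lastTermIndex m 0 f
  kb = lastTermIndex m b f
  ka = lastTermIndex m a f
  b<a : b < a
  b<a = increasing (suc β) (2 + β) (n<1+n _) α<m
  a+b≤f+m : a + b ≤ f + m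
  a+b≤f+m = ≤-trans (≤-reflexive (+-comm a b))
    (≤-trans gap (apery≤frobenius+m {S} {w = w m-1} frob (apery m-1 (n<1+n m-1))))
  a<f : a < f
  a<f = +-cancelʳ-< m a f (<-≤-trans (+-monoʳ-< a m<b) a+b≤f+m)
    where
    m<b : m < b
    m<b = multiplicity<aperyEnumeration {S} {w = w} mult enum z<s (<-trans (n<1+n _) α<m)
  b<f : b < f
  b<f = <-trans b<a a<f
  0<f : 0 < f
  0<f = ≤-<-trans z≤n b<f
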